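{- Let $k$ and $r$ be positive integers with $k\geq 2$ and $1\leq r<k-1$, such that $r$ divides $k-1$. Let $D$ be the diameter of $K(2k+r,k)$ and suppose $D=2p+1$ for an integer $p\geq 1$. If $A$ and $B$ are two distinct vertices of $K_{=2p+1}(2k+r,k)$ which are not adjacent, then their distance in $K_{=2p+1}(2k+r,k)$ is $2$.
   Context: For positive integers $n,k$, $[n]^k$ is the set of $k$-element subsets of $\{1,\dots,n\}$. The Kneser graph $K(2k+r,k)$ has vertex set $[2k+r]^k$, with $A,B$ adjacent iff $A\cap B=\emptyset$; it is connected. For a connected graph $G$ and positive integer $d$, the exact distance-$d$ graph $G_{=d}$ has the same vertex set as $G$, with two vertices adjacent iff their distance in $G$ is exactly $d$. $K_{=d}(2k+r,k)$ denotes the exact distance-$d$ graph of $K(2k+r,k)$. (The diameter of $K(2k+r,k)$ is $\lceil (k-1)/r\rceil+1$.) -}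

module Defs where

open import Data.Nat using (ℕ; zero; suc; _<_; _≤_)
open import Data.Product using (Σ; _×_; ∃; ∃-syntax)
open import Data.Fin.Subset using (Subset; ∣_∣; _∩_; Empty)
open import Relation.Binary.PropositionalEquality using (_≡_)
open import Relation.Nullary using (¬_)

data Walk {V : Set} (E : V → V → Set) : ℕ → V → V → Set where
  nil  : ∀ {x} → Walk E zero x x
  cons : ∀ {n x y z} → E x y → Walk E n y z → Walk E (suc n) x z

Dist : {V : Set} → (V → V → Set) → V → V → ℕ → Set
Dist E x y d = Walk E d x y × (∀ m → m < d → ¬ Walk E m x y)

IsDiameter : {V : Set} → (V → V → Set) → ℕ → Set
IsDiameter {V} E D =
  (∀ (x y : V) → ∃[ d ] (d ≤ D × Dist E x y d)) × (∃[ x ] ∃[ y ] Dist E x y D)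

ExactDist : {V : Set} → (V → V → Set) → ℕ → V → V → Set
ExactDist E d x y = Dist E x y d

KVertex : ℕ → ℕ → Set
KVertex n k = Σ (Subset n) (λ A → ∣ A ∣ ≡ k)

KAdj : (n k : ℕ) → KVertex n k → KVertex n k → Set
KAdj n k (A Data.Product., _) (B Data.Product., _) = Empty (A ∩ B)

{-# OPTIONS --safe #-}
module Submission where

-- For k-sets X, X', Y of a (2k + r)-set with X ~ X', the numbers t = ∣X ∩ Y∣ and t' = ∣X' ∩ Y∣
-- satisfy t + t' ≤ k ≤ t + t' + r, and every t' in that range is realised by some neighbour X'.
-- By induction, X and Y are joined by a walk of length at most 2j + 1 iff t ≤ jr or k ≤ t + jr.
-- Hence, when r ∣ k - 1, diameter 2p + 1 forces k = 2pr + 1: for larger k a vertex meeting X in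
-- pr + 1 points is farther than 2p + 1, for smaller k every pair is within 2p. With k = 2pr + 1,
-- vertices meeting in exactly pr points are at distance exactly 2p + 1, and any A, B have a common
-- such partner C, assembled from the four Venn regions of A and B.

open import Defs
open import Data.Nat using (ℕ; _+_; _*_; _∸_; _≤_; _<_)
open import Data.Nat.Divisibility using (_∣_)
open import Relation.Binary.PropositionalEquality using (_≡_)
open import Relation.Nullary using (¬_)

open import Data.Nat using (zero; suc; z≤n; s≤s; _≤?_; NonZero; >-nonZero)
open import Data.Nat.Properties
open import Data.Nat.Divisibility using (divides)
open import Data.Nat.Tactic.RingSolver using (solve-∀)
open import Algebra.Properties.CommutativeSemigroup +-commutativeSemigroup
  using (interchange; x∙yz≈y∙xz)
open import Data.Vec using ([]; _∷_; here)
open import Data.Fin using (zero)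
open import Data.Fin.Subset
  using (Subset; inside; outside; ∣_∣; _∩_; ∁; _∈_; _⊆_; Empty; ⁅_⁆)
open import Data.Fin.Subset.Properties
  using ( ∣∁p∣≡n∸∣p∣; ∣p∩q∣≤∣p∣; ∩-comm; ∩-idem; drop-∷-Empty; p⊆q⇒∣p∣≤∣q∣
        ; ∣⁅x⁆∣≡1; x∈⁅y⁆⇒x≡y; _∈?_; x∈p∩q⁺; x∉p⇒x∈∁p; ⊆-antisym)
open import Data.Product using (_×_; _,_; proj₁; proj₂; ∃-syntax; map)
open import Data.Sum using (_⊎_; inj₁; inj₂)
open import Relation.Binary.PropositionalEquality
  using (refl; sym; trans; cong; cong₂; subst; subst₂; module ≡-Reasoning)
open import Function using (id)
open import Relation.Nullary using (yes; no; contradiction)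
open import Relation.Nullary.Decidable using (decidable-stable)

∣p∩q∣+∣p∩∁q∣≡∣p∣ : ∀ {n} (p q : Subset n) → ∣ p ∩ q ∣ + ∣ p ∩ ∁ q ∣ ≡ ∣ p ∣
∣p∩q∣+∣p∩∁q∣≡∣p∣ []            []            = refl
∣p∩q∣+∣p∩∁q∣≡∣p∣ (outside ∷ p) (_       ∷ q) = ∣p∩q∣+∣p∩∁q∣≡∣p∣ p q
∣p∩q∣+∣p∩∁q∣≡∣p∣ (inside  ∷ p) (inside  ∷ q) = cong suc (∣p∩q∣+∣p∩∁q∣≡∣p∣ p q)
∣p∩q∣+∣p∩∁q∣≡∣p∣ (inside  ∷ p) (outside ∷ q) =
  trans (+-suc _ _) (cong suc (∣p∩q∣+∣p∩∁q∣≡∣p∣ p q))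

∣s∩p∣+∣s∩q∣≤∣s∣ : ∀ {n} (s p q : Subset n) → Empty (p ∩ q) → ∣ s ∩ p ∣ + ∣ s ∩ q ∣ ≤ ∣ s ∣
∣s∩p∣+∣s∩q∣≤∣s∣ []      []            []            _   = z≤n
∣s∩p∣+∣s∩q∣≤∣s∣ (_ ∷ s) (inside  ∷ p) (inside  ∷ q) p∩q=∅ = contradiction (zero , here) p∩q=∅
∣s∩p∣+∣s∩q∣≤∣s∣ (outside ∷ s) (inside  ∷ p) (outside ∷ q) p∩q=∅ =
  ∣s∩p∣+∣s∩q∣≤∣s∣ s p q (drop-∷-Empty p∩q=∅)
∣s∩p∣+∣s∩q∣≤∣s∣ (outside ∷ s) (outside ∷ p) (_       ∷ q) p∩q=∅ =
  ∣s∩p∣+∣s∩q∣≤∣s∣ s p q (drop-∷-Empty p∩q=∅)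
∣s∩p∣+∣s∩q∣≤∣s∣ (inside  ∷ s) (inside  ∷ p) (outside ∷ q) p∩q=∅ =
  s≤s (∣s∩p∣+∣s∩q∣≤∣s∣ s p q (drop-∷-Empty p∩q=∅))
∣s∩p∣+∣s∩q∣≤∣s∣ (inside  ∷ s) (outside ∷ p) (inside  ∷ q) p∩q=∅ =
  subst (_≤ suc ∣ s ∣) (sym (+-suc _ _)) (s≤s (∣s∩p∣+∣s∩q∣≤∣s∣ s p q (drop-∷-Empty p∩q=∅)))
∣s∩p∣+∣s∩q∣≤∣s∣ (inside  ∷ s) (outside ∷ p) (outside ∷ q) p∩q=∅ =
  m≤n⇒m≤1+n (∣s∩p∣+∣s∩q∣≤∣s∣ s p q (drop-∷-Empty p∩q=∅))

∣p∣≡0⇒Empty : ∀ {n} (p : Subset n) → ∣ p ∣ ≡ 0 → Empty p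
∣p∣≡0⇒Empty p ∣p∣≡0 (x , x∈p) = <⇒≱ (s≤s z≤n) (begin
  1           ≡⟨ sym (∣⁅x⁆∣≡1 x) ⟩
  ∣ ⁅ x ⁆ ∣   ≤⟨ p⊆q⇒∣p∣≤∣q∣ ⁅x⁆⊆p ⟩
  ∣ p ∣       ≡⟨ ∣p∣≡0 ⟩
  0           ∎)
  where
  open ≤-Reasoning
  ⁅x⁆⊆p : ⁅ x ⁆ ⊆ p
  ⁅x⁆⊆p y∈⁅x⁆ = subst (_∈ p) (sym (x∈⁅y⁆⇒x≡y x y∈⁅x⁆)) x∈p

Empty[p∩∁q]⇒p⊆q : ∀ {n} (p q : Subset n) → Empty (p ∩ ∁ q) → p ⊆ q
Empty[p∩∁q]⇒p⊆q p q p∩∁q=∅ {x} x∈p =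
  decidable-stable (x ∈? q) (λ x∉q → p∩∁q=∅ (x , x∈p∩q⁺ (x∈p , x∉p⇒x∈∁p x∉q)))

venn-choose : ∀ {n} (p q : Subset n) {a b c e : ℕ} →
  a ≤ ∣ p ∩ q ∣ → b ≤ ∣ p ∩ ∁ q ∣ → c ≤ ∣ ∁ p ∩ q ∣ → e ≤ ∣ ∁ p ∩ ∁ q ∣ →
  ∃[ s ] ∣ s ∣ ≡ a + b + c + e × ∣ s ∩ p ∣ ≡ a + b × ∣ s ∩ q ∣ ≡ a + c
venn-choose [] [] z≤n z≤n z≤n z≤n = [] , refl , refl , refl
venn-choose (inside ∷ p) (inside ∷ q) {suc a} (s≤s a≤) b≤ c≤ e≤
  with s , ∣s∣ , ∣s∩p∣ , ∣s∩q∣ ← venn-choose p q a≤ b≤ c≤ e≤ =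
  inside ∷ s , cong suc ∣s∣ , cong suc ∣s∩p∣ , cong suc ∣s∩q∣
venn-choose (inside ∷ p) (outside ∷ q) {a} {suc b} {c} {e} a≤ (s≤s b≤) c≤ e≤
  with s , ∣s∣ , ∣s∩p∣ , ∣s∩q∣ ← venn-choose p q a≤ b≤ c≤ e≤ =
  inside ∷ s , trans (cong suc ∣s∣) (sym (cong (λ t → t + c + e) (+-suc a b)))
             , trans (cong suc ∣s∩p∣) (sym (+-suc a b)) , ∣s∩q∣
venn-choose (outside ∷ p) (inside ∷ q) {a} {b} {suc c} {e} a≤ b≤ (s≤s c≤) e≤
  with s , ∣s∣ , ∣s∩p∣ , ∣s∩q∣ ← venn-choose p q a≤ b≤ c≤ e≤ =
  inside ∷ s , trans (cong suc ∣s∣) (sym (cong (_+ e) (+-suc (a + b) c)))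
             , ∣s∩p∣ , trans (cong suc ∣s∩q∣) (sym (+-suc a c))
venn-choose (outside ∷ p) (outside ∷ q) {a} {b} {c} {suc e} a≤ b≤ c≤ (s≤s e≤)
  with s , ∣s∣ , ∣s∩p∣ , ∣s∩q∣ ← venn-choose p q a≤ b≤ c≤ e≤ =
  inside ∷ s , trans (cong suc ∣s∣) (sym (+-suc (a + b + c) e)) , ∣s∩p∣ , ∣s∩q∣
venn-choose (inside ∷ p) (inside ∷ q) {zero} z≤n b≤ c≤ e≤ =
  map (outside ∷_) id (venn-choose p q z≤n b≤ c≤ e≤)
venn-choose (inside ∷ p) (outside ∷ q) {b = zero} a≤ z≤n c≤ e≤ =
  map (outside ∷_) id (venn-choose p q a≤ z≤n c≤ e≤)
venn-choose (outside ∷ p) (inside ∷ q) {c = zero} a≤ b≤ z≤n e≤ =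
  map (outside ∷_) id (venn-choose p q a≤ b≤ z≤n e≤)
venn-choose (outside ∷ p) (outside ∷ q) {e = zero} a≤ b≤ c≤ z≤n =
  map (outside ∷_) id (venn-choose p q a≤ b≤ c≤ z≤n)

m∸[m∸n]≤n : ∀ m n → m ∸ (m ∸ n) ≤ n
m∸[m∸n]≤n m n = m≤n+o⇒m∸n≤o m (m ∸ n) (subst (m ≤_) (+-comm n (m ∸ n)) (m≤n+m∸n m n))

2p+1≡suc[p+p] : ∀ p → 2 * p + 1 ≡ suc (p + p)
2p+1≡suc[p+p] = solve-∀

quotient-squeeze : ∀ j q r .{{_ : NonZero r}} →
  suc (suc j * r + j * r) < suc (q * r) → suc (q * r) ≤ suc (suc j * r + suc j * r) →
  q ≡ suc j + suc j
quotient-squeeze j q r lower upper = ≤-antisym q≤ ≤q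
  where
  q≤ : q ≤ suc j + suc j
  q≤ = *-cancelʳ-≤ q (suc j + suc j) r
         (subst (q * r ≤_) (sym (*-distribʳ-+ r (suc j) (suc j))) (≤-pred upper))
  ≤q : suc j + suc j ≤ q
  ≤q = subst (_≤ q) (sym (+-suc (suc j) j))
         (*-cancelʳ-< r (suc j + j) q
           (subst (_< q * r) (sym (*-distribʳ-+ r (suc j) j)) (≤-pred lower)))

dist-two : ∀ {V : Set} {E : V → V → Set} {x y : V} → ¬ x ≡ y → ¬ E x y → Walk E 2 x y → Dist E x y 2
dist-two {E = E} {x} {y} x≢y ¬Exy w = w , shorter
  where
  shorter : ∀ m → m < 2 → ¬ Walk E m x y
  shorter 0 _ nil            = x≢y refl
  shorter 1 _ (cons Exy nil) = ¬Exy Exy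
  shorter (suc (suc _)) (s≤s (s≤s ()))

module KneserGraph (k r : ℕ) where

  Vertex : Set
  Vertex = KVertex (2 * k + r) k

  _~_ : Vertex → Vertex → Set
  _~_ = KAdj (2 * k + r) k

  common : Vertex → Vertex → ℕ
  common (x , _) (y , _) = ∣ x ∩ y ∣

  common-comm : (X Y : Vertex) → common X Y ≡ common Y X
  common-comm (x , _) (y , _) = cong ∣_∣ (∩-comm x y)

  common-self : (X : Vertex) → common X X ≡ k
  common-self (x , ∣x∣≡k) = trans (cong ∣_∣ (∩-idem x)) ∣x∣≡k

  common≤k : (X Y : Vertex) → common X Y ≤ k
  common≤k (x , ∣x∣≡k) (y , _) = subst (∣ x ∩ y ∣ ≤_) ∣x∣≡k (∣p∩q∣≤∣p∣ x y)

  common+∣x∩∁y∣≡k : ((x , _) (y , _) : Vertex) → ∣ x ∩ y ∣ + ∣ x ∩ ∁ y ∣ ≡ k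
  common+∣x∩∁y∣≡k (x , ∣x∣≡k) (y , _) = trans (∣p∩q∣+∣p∩∁q∣≡∣p∣ x y) ∣x∣≡k

  ∣x∩∁y∣≡k∸common : ((x , _) (y , _) : Vertex) → ∣ x ∩ ∁ y ∣ ≡ k ∸ ∣ x ∩ y ∣
  ∣x∩∁y∣≡k∸common X@(x , _) Y@(y , _) =
    sym (trans (cong (_∸ ∣ x ∩ y ∣) (sym (common+∣x∩∁y∣≡k X Y))) (m+n∸m≡n ∣ x ∩ y ∣ _))

  ∣∁x∣≡k+r : ((x , _) : Vertex) → ∣ ∁ x ∣ ≡ k + r
  ∣∁x∣≡k+r (x , ∣x∣≡k) = begin
    ∣ ∁ x ∣              ≡⟨ ∣∁p∣≡n∸∣p∣ x ⟩
    2 * k + r ∸ ∣ x ∣    ≡⟨ cong₂ _∸_ (2k+r≡k+[k+r] k r) ∣x∣≡k ⟩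
    k + (k + r) ∸ k      ≡⟨ m+n∸m≡n k (k + r) ⟩
    k + r                ∎
    where
    open ≡-Reasoning
    2k+r≡k+[k+r] : ∀ k r → 2 * k + r ≡ k + (k + r)
    2k+r≡k+[k+r] = solve-∀

  ∣∁x∩∁y∣≡common+r : ((x , _) (y , _) : Vertex) → ∣ ∁ x ∩ ∁ y ∣ ≡ ∣ x ∩ y ∣ + r
  ∣∁x∩∁y∣≡common+r X@(x , _) Y@(y , _) = +-cancelˡ-≡ u _ _ (begin
    u + ∣ ∁ x ∩ ∁ y ∣  ≡⟨ ∣p∩q∣+∣p∩∁q∣≡∣p∣ (∁ x) y ⟩
    ∣ ∁ x ∣            ≡⟨ ∣∁x∣≡k+r X ⟩
    k + r              ≡⟨ cong (_+ r) (sym t+u≡k) ⟩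
    t + u + r          ≡⟨ cong (_+ r) (+-comm t u) ⟩
    u + t + r          ≡⟨ +-assoc u t r ⟩
    u + (t + r)        ∎)
    where
    open ≡-Reasoning
    t = ∣ x ∩ y ∣
    u = ∣ ∁ x ∩ y ∣
    t+u≡k : t + u ≡ k
    t+u≡k = trans (cong₂ _+_ (common-comm X Y) (cong ∣_∣ (∩-comm (∁ x) y))) (common+∣x∩∁y∣≡k Y X)

  common⇒⊆ : (X Y : Vertex) → k ≤ common X Y → proj₁ X ⊆ proj₁ Y
  common⇒⊆ X@(x , _) Y@(y , _) k≤t = Empty[p∩∁q]⇒p⊆q x y (∣p∣≡0⇒Empty (x ∩ ∁ y) u≡0)
    where
    t≡k : common X Y ≡ k
    t≡k = ≤-antisym (common≤k X Y) k≤t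
    u≡0 : ∣ x ∩ ∁ y ∣ ≡ 0
    u≡0 = trans (∣x∩∁y∣≡k∸common X Y) (trans (cong (k ∸_) t≡k) (n∸n≡0 k))

  ≡-from-common : (X Y : Vertex) → k ≤ common X Y → X ≡ Y
  ≡-from-common X@(x , ∣x∣≡k) Y@(y , ∣y∣≡k) k≤t
    with refl ← ⊆-antisym (common⇒⊆ X Y k≤t) (common⇒⊆ Y X (subst (k ≤_) (common-comm X Y) k≤t)) =
    cong (x ,_) (≡-irrelevant ∣x∣≡k ∣y∣≡k)

  common≡0⇒~ : (X Y : Vertex) → common X Y ≡ 0 → X ~ Y
  common≡0⇒~ (x , _) (y , _) = ∣p∣≡0⇒Empty (x ∩ y)

  vertex-with-commons : (X Y : Vertex) {a b c e : ℕ} →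
    a ≤ common X Y → b ≤ k ∸ common X Y → c ≤ k ∸ common X Y → e ≤ common X Y + r →
    a + b + c + e ≡ k → ∃[ Z ] common X Z ≡ a + b × common Z Y ≡ a + c
  vertex-with-commons X@(x , _) Y@(y , _) a≤t b≤k∸t c≤k∸t e≤t+r a+b+c+e≡k =
    let z , ∣z∣ , ∣z∩x∣ , ∣z∩y∣ = venn-choose x y a≤t b≤∣x∩∁y∣ c≤∣∁x∩y∣ e≤∣∁x∩∁y∣
    in (z , trans ∣z∣ a+b+c+e≡k) , trans (cong ∣_∣ (∩-comm x z)) ∣z∩x∣ , ∣z∩y∣
    where
    b≤∣x∩∁y∣ : _ ≤ ∣ x ∩ ∁ y ∣
    b≤∣x∩∁y∣ = subst (_ ≤_) (sym (∣x∩∁y∣≡k∸common X Y)) b≤k∸t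
    c≤∣∁x∩y∣ : _ ≤ ∣ ∁ x ∩ y ∣
    c≤∣∁x∩y∣ = subst (_ ≤_) (trans (cong (k ∸_) (common-comm X Y))
                                 (trans (sym (∣x∩∁y∣≡k∸common Y X)) (cong ∣_∣ (∩-comm y (∁ x)))))
                     c≤k∸t
    e≤∣∁x∩∁y∣ : _ ≤ ∣ ∁ x ∩ ∁ y ∣
    e≤∣∁x∩∁y∣ = subst (_ ≤_) (sym (∣∁x∩∁y∣≡common+r X Y)) e≤t+r

  ~-common-bounds : (X X' Y : Vertex) → X ~ X' →
    common X Y + common X' Y ≤ k × k ≤ common X Y + common X' Y + r
  ~-common-bounds X@(x , _) X'@(x' , _) Y@(y , ∣y∣≡k) x∩x'=∅ = upper , lower
    where
    t₁ = ∣ x ∩ y ∣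
    t₂ = ∣ x' ∩ y ∣
    u₁ = ∣ x ∩ ∁ y ∣
    u₂ = ∣ x' ∩ ∁ y ∣
    upper : t₁ + t₂ ≤ k
    upper = subst₂ _≤_ (cong₂ _+_ (common-comm Y X) (common-comm Y X')) ∣y∣≡k
                   (∣s∩p∣+∣s∩q∣≤∣s∣ y x x' x∩x'=∅)
    -- The lower bound is the upper bound with ∁ y, of size k + r, in place of y.
    u₁+u₂≤k+r : u₁ + u₂ ≤ k + r
    u₁+u₂≤k+r = subst₂ _≤_ (cong₂ _+_ (cong ∣_∣ (∩-comm (∁ y) x)) (cong ∣_∣ (∩-comm (∁ y) x')))
                       (∣∁x∣≡k+r Y) (∣s∩p∣+∣s∩q∣≤∣s∣ (∁ y) x x' x∩x'=∅)
    lower : k ≤ t₁ + t₂ + r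
    lower = +-cancelˡ-≤ k _ _ (begin
      k + k                  ≡⟨ cong₂ _+_ (common+∣x∩∁y∣≡k X Y) (common+∣x∩∁y∣≡k X' Y) ⟨
      (t₁ + u₁) + (t₂ + u₂)  ≡⟨ interchange t₁ u₁ t₂ u₂ ⟩
      (t₁ + t₂) + (u₁ + u₂)  ≤⟨ +-monoʳ-≤ (t₁ + t₂) u₁+u₂≤k+r ⟩
      (t₁ + t₂) + (k + r)    ≡⟨ x∙yz≈y∙xz (t₁ + t₂) k r ⟩
      k + (t₁ + t₂ + r)      ∎)
      where open ≤-Reasoning

  ~⇒common≤ : (X X' Y : Vertex) {s : ℕ} → X ~ X' → k ≤ common X' Y + s → common X Y ≤ s
  ~⇒common≤ X X' Y {s} X~X' k≤t'+s = +-cancelʳ-≤ (common X' Y) (common X Y) s (begin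
    common X Y + common X' Y  ≤⟨ proj₁ (~-common-bounds X X' Y X~X') ⟩
    k                         ≤⟨ k≤t'+s ⟩
    common X' Y + s           ≡⟨ +-comm (common X' Y) s ⟩
    s + common X' Y           ∎)
    where open ≤-Reasoning

  ~⇒k≤common+ : (X X' Y : Vertex) {s : ℕ} → X ~ X' → common X' Y + r ≤ s → k ≤ common X Y + s
  ~⇒k≤common+ X X' Y {s} X~X' t'+r≤s = begin
    k                               ≤⟨ proj₂ (~-common-bounds X X' Y X~X') ⟩
    common X Y + common X' Y + r    ≡⟨ +-assoc (common X Y) _ r ⟩
    common X Y + (common X' Y + r)  ≤⟨ +-monoʳ-≤ (common X Y) t'+r≤s ⟩
    common X Y + s                  ∎
    where open ≤-Reasoning

  k≤common-self+ : (X : Vertex) (s : ℕ) → k ≤ common X X + s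
  k≤common-self+ X s = subst (λ t → k ≤ t + s) (sym (common-self X)) (m≤m+n k s)

  -- common X Y + r ≤ j * r reads t ≤ (j - 1) r without truncated subtraction.
  within-odd : ∀ {m} j {X Y : Vertex} → Walk _~_ m X Y → m ≤ suc (j + j) →
    k ≤ common X Y + j * r ⊎ common X Y ≤ j * r
  within-even : ∀ {m} j {X Y : Vertex} → Walk _~_ m X Y → m ≤ j + j →
    k ≤ common X Y + j * r ⊎ common X Y + r ≤ j * r

  within-odd j {X} nil _ = inj₁ (k≤common-self+ X (j * r))
  within-odd j {X} {Y} (cons {y = X'} X~X' w) (s≤s m≤2j) with within-even j w m≤2j
  ... | inj₁ k≤t'+jr = inj₂ (~⇒common≤ X X' Y X~X' k≤t'+jr)
  ... | inj₂ t'+r≤jr = inj₁ (~⇒k≤common+ X X' Y X~X' t'+r≤jr)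

  within-even j {X} nil _ = inj₁ (k≤common-self+ X (j * r))
  within-even (suc j) {X} {Y} (cons {y = X'} X~X' w) (s≤s m≤2j+1)
    with within-odd j w (≤-trans m≤2j+1 (≤-reflexive (+-suc j j)))
  ... | inj₁ k≤t'+jr = inj₂ (subst (common X Y + r ≤_) (+-comm (j * r) r)
                         (+-monoˡ-≤ r (~⇒common≤ X X' Y X~X' k≤t'+jr)))
  ... | inj₂ t'≤jr   = inj₁ (~⇒k≤common+ X X' Y X~X'
                         (subst (common X' Y + r ≤_) (+-comm (j * r) r) (+-monoˡ-≤ r t'≤jr)))

  neighbour-with-common : (X Y : Vertex) {c : ℕ} → c ≤ k ∸ common X Y → k ∸ c ≤ common X Y + r →
    ∃[ Z ] X ~ Z × common Z Y ≡ c
  neighbour-with-common X Y {c} c≤k∸t k∸c≤t+r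
    with Z , X∩Z≡0 , Z∩Y≡c ← vertex-with-commons X Y z≤n z≤n c≤k∸t k∸c≤t+r
                                (m+[n∸m]≡n (≤-trans c≤k∸t (m∸n≤m k (common X Y)))) =
    Z , common≡0⇒~ X Z X∩Z≡0 , Z∩Y≡c

  walk-even : ∀ j (X Y : Vertex) → k ≤ common X Y + j * r → Walk _~_ (j + j) X Y
  walk-odd  : ∀ j (X Y : Vertex) → common X Y ≤ j * r → Walk _~_ (suc (j + j)) X Y

  walk-even zero X Y k≤t+0 =
    subst (Walk _~_ 0 X) (≡-from-common X Y (subst (k ≤_) (+-identityʳ _) k≤t+0)) nil
  walk-even (suc j) X Y k≤t+r+jr
    with Z , X~Z , Z∩Y≡c ← neighbour-with-common X Y (∸-monoʳ-≤ k (m≤m+n (common X Y) r))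
                                                     (m∸[m∸n]≤n k (common X Y + r)) =
    subst (λ m → Walk _~_ m X Y) (cong suc (sym (+-suc j j)))
          (cons X~Z (walk-odd j Z Y (subst (_≤ j * r) (sym Z∩Y≡c) c≤jr)))
    where
    t = common X Y
    c≤jr : k ∸ (t + r) ≤ j * r
    c≤jr = m≤n+o⇒m∸n≤o k (t + r) (subst (k ≤_) (sym (+-assoc t r (j * r))) k≤t+r+jr)
  walk-odd j X Y t≤jr
    with Z , X~Z , Z∩Y≡c ← neighbour-with-common X Y ≤-refl
                             (≤-trans (m∸[m∸n]≤n k (common X Y)) (m≤m+n (common X Y) r)) =
    cons X~Z (walk-even j Z Y (subst (λ c → k ≤ c + j * r) (sym Z∩Y≡c) k≤c+jr))
    where
    t = common X Y
    k≤c+jr : k ≤ (k ∸ t) + j * r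
    k≤c+jr = begin
      k                ≤⟨ m≤n+m∸n k t ⟩
      t + (k ∸ t)      ≤⟨ +-monoˡ-≤ (k ∸ t) t≤jr ⟩
      j * r + (k ∸ t)  ≡⟨ +-comm (j * r) (k ∸ t) ⟩
      (k ∸ t) + j * r  ∎
      where open ≤-Reasoning

  vertex-with-common : (X : Vertex) {a : ℕ} → a ≤ k → ∃[ Y ] common X Y ≡ a
  vertex-with-common X {a} a≤k
    with Y , X∩Y≡a+0 , _ ← vertex-with-commons X X {a} {0} {0} {k ∸ a}
                              (subst (a ≤_) (sym (common-self X)) a≤k) z≤n z≤n
                              (subst (λ t → k ∸ a ≤ t + r) (sym (common-self X))
                                     (≤-trans (m∸n≤m k a) (m≤m+n k r)))
                              (trans (cong (_+ (k ∸ a)) (trans (+-identityʳ _) (+-identityʳ a)))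
                                     (m+[n∸m]≡n a≤k)) =
    Y , trans X∩Y≡a+0 (+-identityʳ a)

  eccentric-vertex : ∀ j → suc (j * r + j * r) < k → (X : Vertex) →
    ∃[ Y ] (∀ {m} → m ≤ suc (j + j) → ¬ Walk _~_ m X Y)
  eccentric-vertex j 2jr+1<k X
    with Y , X∩Y≡1+jr ← vertex-with-common X (≤-trans (s≤s (m≤m+n (j * r) (j * r))) (<⇒≤ 2jr+1<k)) =
    Y , unreachable
    where
    unreachable : ∀ {m} → m ≤ suc (j + j) → ¬ Walk _~_ m X Y
    unreachable m≤2j+1 w with within-odd j w m≤2j+1
    ... | inj₁ k≤t+jr = <⇒≱ 2jr+1<k (subst (λ t → k ≤ t + j * r) X∩Y≡1+jr k≤t+jr)
    ... | inj₂ t≤jr   = 1+n≰n (subst (_≤ j * r) X∩Y≡1+jr t≤jr)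

  every-pair-within : ∀ j → k ≤ suc (suc j * r + j * r) → (X Y : Vertex) →
    ∃[ m ] m ≤ suc j + suc j × Walk _~_ m X Y
  every-pair-within j k≤ X Y with common X Y ≤? j * r
  ... | yes t≤jr = suc (j + j) , s≤s (+-monoʳ-≤ j (n≤1+n j)) , walk-odd j X Y t≤jr
  ... | no  t≰jr = suc j + suc j , ≤-refl , walk-even (suc j) X Y (begin
    k                        ≤⟨ k≤ ⟩
    suc (suc j * r + j * r)  ≡⟨ +-suc (suc j * r) (j * r) ⟨
    suc j * r + suc (j * r)  ≤⟨ +-monoʳ-≤ (suc j * r) (≰⇒> t≰jr) ⟩
    suc j * r + common X Y   ≡⟨ +-comm (suc j * r) (common X Y) ⟩
    common X Y + suc j * r   ∎)
    where open ≤-Reasoning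

  k≤-from-diameter : ∀ p → IsDiameter _~_ (2 * p + 1) → k ≤ suc (p * r + p * r)
  k≤-from-diameter p (within-diameter , X , _) = ≮⇒≥ λ 2pr+1<k →
    let Y , unreachable = eccentric-vertex p 2pr+1<k X
        d , d≤2p+1 , w , _ = within-diameter X Y
    in unreachable (subst (d ≤_) (2p+1≡suc[p+p] p) d≤2p+1) w

  <k-from-diameter : ∀ j → IsDiameter _~_ (2 * suc j + 1) → suc (suc j * r + j * r) < k
  <k-from-diameter j (_ , X , Y , _ , shorter) = ≰⇒> λ k≤ →
    let m , m≤2j+2 , w = every-pair-within j k≤ X Y
    in shorter m (subst (m <_) (sym (2p+1≡suc[p+p] (suc j))) (s≤s m≤2j+2)) w

  k≡-from-diameter : ∀ j q → 1 ≤ r → k ≡ suc (q * r) → IsDiameter _~_ (2 * suc j + 1) →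
    k ≡ suc (suc j * r + suc j * r)
  k≡-from-diameter j q 1≤r k≡1+qr diameter = begin
    k                              ≡⟨ k≡1+qr ⟩
    suc (q * r)                    ≡⟨ cong (λ q → suc (q * r)) q≡2[1+j] ⟩
    suc ((suc j + suc j) * r)      ≡⟨ cong suc (*-distribʳ-+ r (suc j) (suc j)) ⟩
    suc (suc j * r + suc j * r)    ∎
    where
    open ≡-Reasoning
    q≡2[1+j] : q ≡ suc j + suc j
    q≡2[1+j] = quotient-squeeze j q r {{>-nonZero 1≤r}}
                 (subst (suc (suc j * r + j * r) <_) k≡1+qr (<k-from-diameter j diameter))
                 (subst (_≤ suc (suc j * r + suc j * r)) k≡1+qr (k≤-from-diameter (suc j) diameter))

  dist-of-common : ∀ p → 1 ≤ r → k ≡ suc (p * r + p * r) → (X Y : Vertex) → common X Y ≡ p * r →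
    Dist _~_ X Y (2 * p + 1)
  dist-of-common p 1≤r k≡1+2pr X Y t≡pr =
    subst (λ m → Walk _~_ m X Y) (sym (2p+1≡suc[p+p] p)) (walk-odd p X Y (≤-reflexive t≡pr))
    , shorter
    where
    shorter : ∀ m → m < 2 * p + 1 → ¬ Walk _~_ m X Y
    shorter m m<2p+1 w with within-even p w (≤-pred (subst (m <_) (2p+1≡suc[p+p] p) m<2p+1))
    ... | inj₁ k≤t+pr = 1+n≰n (subst₂ _≤_ k≡1+2pr (cong (_+ p * r) t≡pr) k≤t+pr)
    ... | inj₂ t+r≤pr = <⇒≱ (m<m+n (p * r) 1≤r) (subst (λ t → t + r ≤ p * r) t≡pr t+r≤pr)

  vertex-between : (A B : Vertex) {a d P : ℕ} → 1 ≤ r → k ≡ suc (P + P) → a + d ≡ P →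
    a ≤ common A B → d ≤ k ∸ common A B → ∃[ C ] common A C ≡ P × common C B ≡ P
  vertex-between A B {a} {d} 1≤r k≡1+2P a+d≡P a≤t d≤k∸t =
    let C , A∩C≡a+d , C∩B≡a+d = vertex-with-commons A B a≤t d≤k∸t d≤k∸t 1+a≤t+r sum≡k
    in C , trans A∩C≡a+d a+d≡P , trans C∩B≡a+d a+d≡P
    where
    1+a≤t+r : suc a ≤ common A B + r
    1+a≤t+r = subst (_≤ common A B + r) (+-comm a 1) (+-mono-≤ a≤t 1≤r)
    a+d+d+1+a≡1+2[a+d] : ∀ a d → a + d + d + suc a ≡ suc (a + d + (a + d))
    a+d+d+1+a≡1+2[a+d] = solve-∀
    sum≡k : a + d + d + suc a ≡ k
    sum≡k = trans (a+d+d+1+a≡1+2[a+d] a d) (trans (cong (λ P → suc (P + P)) a+d≡P) (sym k≡1+2P))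

  middle-vertex : ∀ P → 1 ≤ r → k ≡ suc (P + P) → (A B : Vertex) →
    ∃[ C ] common A C ≡ P × common C B ≡ P
  middle-vertex P 1≤r k≡1+2P A B with P ≤? common A B
  ... | yes P≤t = vertex-between A B 1≤r k≡1+2P (+-identityʳ P) P≤t z≤n
  ... | no  P≰t with d , t+d≡P ← m≤n⇒∃[o]m+o≡n (<⇒≤ (≰⇒> P≰t)) =
    vertex-between A B 1≤r k≡1+2P t+d≡P ≤-refl (m+n≤o⇒m≤o∸n d (begin
      d + common A B  ≡⟨ +-comm d (common A B) ⟩
      common A B + d  ≡⟨ t+d≡P ⟩
      P               ≤⟨ m≤m+n P P ⟩
      P + P           <⟨ n<1+n (P + P) ⟩
      suc (P + P)     ≡⟨ k≡1+2P ⟨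
      k               ∎))
    where open ≤-Reasoning

mainTheorem12 : (k r p : ℕ) → 2 ≤ k → 1 ≤ r → r < k ∸ 1 → r ∣ k ∸ 1 → 1 ≤ p →
    IsDiameter (KAdj (2 * k + r) k) (2 * p + 1) →
    (A B : KVertex (2 * k + r) k) → ¬ A ≡ B →
    ¬ ExactDist (KAdj (2 * k + r) k) (2 * p + 1) A B →
    Dist (ExactDist (KAdj (2 * k + r) k) (2 * p + 1)) A B 2
mainTheorem12 k@(suc k-1) r p@(suc j) (s≤s _) 1≤r _ (divides q k-1≡qr) (s≤s _) diameter A B A≢B A≁B =
  let C , A∩C≡pr , C∩B≡pr = middle-vertex (p * r) 1≤r k≡1+2pr A B
  in dist-two A≢B A≁B (cons (at-distance A C A∩C≡pr) (cons (at-distance C B C∩B≡pr) nil))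
  where
  open KneserGraph k r
  k≡1+2pr : k ≡ suc (p * r + p * r)
  k≡1+2pr = k≡-from-diameter j q 1≤r (cong suc k-1≡qr) diameter
  at-distance : (X Y : Vertex) → common X Y ≡ p * r → Dist _~_ X Y (2 * p + 1)
  at-distance = dist-of-common p 1≤r k≡1+2pr
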